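{- Let $a,b$ be coprime positive integers and $D$ an $a,b$-Dyck path with $\pi(D)=(P,Q)$. Then \[\ell(D)=\{(i,\max B): B\in\mathrm{Krew}(P),\ i\in B,\ i\ne\max B\}\cup\{(\max B,\max B): B\in Q,\ \mathrm{rank}(B)\ne 0\}.\]
   Context: An $a,b$-Dyck path is a lattice path from $(0,0)$ to $(b,a)$ with unit north steps $N$ and east steps $E$ staying above the line $y=\frac{a}{b}x$; write it as $D=N^{v_0}EN^{v_1}E\cdots N^{v_{b-1}}E$, $v_i\ge 0$. A vertical run of length $v$ is a $P$-rise if $v>a/b$ and a $Q$-rise if $v<a/b$. For $1\le i\le b-1$ the label $i$ is the point $(i,v_0+\dots+v_{i-1})$. If $v_i>0$, the laser $\ell(i)$ is the segment of slope $a/b$ from label $i$ going northeast until it next meets $D$ (in the interior of an east step). The laser set $\ell(D)$ is the set of pairs $(i,j)$ with $\ell(i)$ ending on the east step whose west endpoint has $x$-coordinate $j$. The labeled pair $\pi(D)=(P,Q)$ of set partitions of $[b-1]$: $i,j$ in the same block of $P$ iff labels $i,j$ are not separated by any laser (label $k$ lies strictly below $\ell(k)$), and a block $B\in P$ gets rank $v_{\min(B)-1}$; $Q$ is the equivalence relation generated by $i\sim j$ whenever $\ell(i),\ell(j)$ end on the same east step immediately following a $Q$-rise, or $(i,j)\in\ell(D)$, or $(j,i)\in\ell(D)$, and a block $B\in Q$ gets rank $\mathrm{rank}(B)=v_{\max(B)}$. $P$ is noncrossing. Kreweras complement: for a noncrossing partition $P$ of $[n]$, place $1,1',\dots,n,n'$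 clockwise on a circle and draw $P$ on the unprimed points; $\mathrm{Krew}(P)$ is the coarsest partition of the primed points (identified with $[n]$) introducing no crossings. -}

module Defs where

open import Data.Nat using (ℕ; zero; suc; _+_; _*_; _∸_; _≤_; _<_)
open import Data.List using (List; []; _∷_; take; length)
open import Data.Nat.ListAction using (sum)
open import Data.Product using (Σ; ∃; ∃-syntax; _×_; _,_)
open import Data.Sum using (_⊎_)
open import Data.Empty using (⊥)
open import Relation.Nullary using (¬_)
open import Relation.Binary.PropositionalEquality using (_≡_; _≢_)
open import Relation.Binary.Construct.Closure.Equivalence using (EqClosure)

-- An a,b-path D = N^{v_0} E N^{v_1} E ... N^{v_{b-1}} E is given by the list
-- vs = [v_0, ..., v_{b-1}].  v i = v_i (0 outside the range).
v : List ℕ → ℕ → ℕ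
v []       _       = 0
v (x ∷ _)  zero    = x
v (_ ∷ xs) (suc i) = v xs i

-- S k = v_0 + ... + v_{k-1}  (height of label k / of east step k-1)
S : List ℕ → ℕ → ℕ
S vs k = sum (take k vs)

-- a,b-Dyck path: ends at (b,a) and stays (weakly) above y = (a/b) x.
-- The lowest points of the path are the east endpoints (k, S k), k = 1..b.
IsDyck : ℕ → ℕ → List ℕ → Set
IsDyck a b vs =
  (length vs ≡ b) × (sum vs ≡ a) ×
  (∀ k → 1 ≤ k → k ≤ b → a * k ≤ b * S vs k)

-- Laser ℓ(i) ends on the east step whose west endpoint has x-coordinate j.
-- The laser from label i = (i, S i) is y = S i + (a/b)(x - i).  It ends on
-- east step j (from (j, S(j+1)) to (j+1, S(j+1))) iff it is strictly below
-- the path at the right end of each earlier east step k (i ≤ k < j) and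
-- strictly above the step's height at x = j+1 (it crosses step j).
LaserEnds : ℕ → ℕ → List ℕ → ℕ → ℕ → Set
LaserEnds a b vs i j =
  (1 ≤ i) × (i ≤ j) × (j < b) × (0 < v vs i) ×
  (b * S vs (suc j) < b * S vs i + a * (suc j ∸ i)) ×
  (∀ k → i ≤ k → k < j → b * S vs i + a * (suc k ∸ i) < b * S vs (suc k))

-- Labels strictly above the laser ℓ(k) ending on step m: k < p ≤ m
-- (label k itself lies strictly below ℓ(k)).
Inside : ℕ → ℕ → ℕ → Set
Inside k m p = (k < p) × (p ≤ m)

Separated : ℕ → ℕ → List ℕ → ℕ → ℕ → Set
Separated a b vs i j =
  ∃[ k ] ∃[ m ] (LaserEnds a b vs k m ×
    ((Inside k m i × ¬ Inside k m j) ⊎ (¬ Inside k m i × Inside k m j)))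

InRange : ℕ → ℕ → Set
InRange n i = (1 ≤ i) × (i ≤ n)

Prel : ℕ → ℕ → List ℕ → ℕ → ℕ → Set
Prel a b vs i j = InRange (b ∸ 1) i × InRange (b ∸ 1) j × ¬ Separated a b vs i j

QGen : ℕ → ℕ → List ℕ → ℕ → ℕ → Set
QGen a b vs i j =
  (∃[ m ] (LaserEnds a b vs i m × LaserEnds a b vs j m × (b * v vs m < a)))
  ⊎ LaserEnds a b vs i j ⊎ LaserEnds a b vs j i

Qrel : ℕ → ℕ → List ℕ → ℕ → ℕ → Set
Qrel a b vs i j = InRange (b ∸ 1) i × InRange (b ∸ 1) j × EqClosure (QGen a b vs) i j

IsPartition : ℕ → (ℕ → ℕ → Set) → Set
IsPartition n R =
  (∀ i j → R i j → InRange n i × InRange n j) ×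
  (∀ i → InRange n i → R i i) ×
  (∀ i j → R i j → R j i) ×
  (∀ i j k → R i j → R j k → R i k)

-- points 1,1',2,2',...,n,n' on the circle (in clockwise order)
data Pt : Set where
  unp : ℕ → Pt
  pri : ℕ → Pt

pos : Pt → ℕ
pos (unp i) = 2 * i
pos (pri i) = suc (2 * i)

Comb : (ℕ → ℕ → Set) → (ℕ → ℕ → Set) → Pt → Pt → Set
Comb P K (unp i) (unp j) = P i j
Comb P K (pri i) (pri j) = K i j
Comb P K _ _ = ⊥

NonCrossing : (Pt → Pt → Set) → Set
NonCrossing C = ¬ (∃[ x ] ∃[ y ] ∃[ z ] ∃[ w ]
  ((pos x < pos y) × (pos y < pos z) × (pos z < pos w) ×
   C x z × C y w × ¬ C x y))

IsKrew : ℕ → (ℕ → ℕ → Set) → (ℕ → ℕ → Set) → Set₁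
IsKrew n P K =
  IsPartition n K × NonCrossing (Comb P K) ×
  (∀ K' → IsPartition n K' → NonCrossing (Comb P K') → ∀ i j → K' i j → K i j)

IsMaxOf : (ℕ → ℕ → Set) → ℕ → Set
IsMaxOf R j = ∀ k → R j k → k ≤ j

-- Lasers are laminar: a laser starting at a label that lies under ℓ(k) ends no later than ℓ(k).
-- Hence root i, the end of ℓ(i) (or i itself when there is no laser), is idempotent, and
-- ℓ(D) consists of the pairs (i, root i) for which ℓ(i) exists.  The fibres of root form a
-- partition which does not cross P, and it is the coarsest such partition, so it is Krew(P);
-- in particular the maxima of the blocks of Krew(P) are the fixed points of root.  All
-- generators of Q preserve root, so a laser (j, j) makes j the maximum of its block of Q.
module Submission where

open import Defs
open import Data.Nat
  using (ℕ; zero; suc; _+_; _*_; _∸_; _≤_; _<_; _≟_; _<?_; _≤?_; z≤n; s≤s; s≤s⁻¹; s<s⁻¹)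
open import Data.Nat.Properties
open import Data.Nat.Coprimality using (Coprime; coprime-divisor)
import Data.Nat.Coprimality as Coprime
open import Data.Nat.Divisibility using (_∣_; ∣⇒≤; m∣m*n; ∣m+n∣m⇒∣n)
open import Data.Nat.ListAction using (sum)
open import Data.List using (List; filter; upTo)
open import Data.List.Properties using (take-all)
open import Data.List.Membership.Propositional.Properties
  using (∈-filter⁺; ∈-filter⁻; ∈-upTo⁺; ∈-upTo⁻)
import Data.List.Relation.Unary.All as All
open import Data.List.Extrema ≤-totalOrder using (max; xs≤max; argmax-all)
import Data.Product as Product
open import Data.Product using (∃-syntax; _×_; _,_; proj₁; proj₂)
import Data.Sum as Sum
open import Data.Sum using (_⊎_; inj₁; inj₂; [_,_]′)
open import Data.Empty using (⊥-elim)
open import Function.Base using (id; _∘_)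
open import Function.Bundles using (_⇔_; mk⇔; Equivalence)
open import Relation.Nullary using (¬_; yes; no; contradiction)
open import Relation.Nullary.Decidable using (_×-dec_)
open import Relation.Unary using (Decidable)
open import Relation.Binary.Definitions using (tri<; tri≈; tri>)
open import Relation.Binary.PropositionalEquality
  using (_≡_; _≢_; refl; sym; trans; cong; subst; isEquivalence; module ≡-Reasoning)
open import Relation.Binary.Construct.Closure.ReflexiveTransitive using (ε)
open import Relation.Binary.Construct.Closure.Equivalence using (gfold; return)

∸-split : ∀ {m n o} → o ≤ n → n ≤ m → m ∸ o ≡ (n ∸ o) + (m ∸ n)
∸-split {m} {n} {o} o≤n n≤m = begin
  m ∸ o              ≡⟨ cong (_∸ o) (sym (m∸n+n≡m n≤m)) ⟩
  (m ∸ n) + n ∸ o    ≡⟨ +-∸-assoc (m ∸ n) o≤n ⟩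
  (m ∸ n) + (n ∸ o)  ≡⟨ +-comm (m ∸ n) (n ∸ o) ⟩
  (n ∸ o) + (m ∸ n)  ∎
  where open ≡-Reasoning

-- A line of slope a/b through a lattice point meets no lattice point at horizontal distance 0 < d < b.
b*x+a*d≢b*y : ∀ {a b d} → Coprime a b → 0 < d → d < b → ∀ x y → b * x + a * d ≢ b * y
b*x+a*d≢b*y {a} {b} {d@(suc _)} cop _ d<b x y eq = <⇒≱ d<b (∣⇒≤ b∣d)
  where
  b∣a*d : b ∣ a * d
  b∣a*d = ∣m+n∣m⇒∣n (subst (b ∣_) (sym eq) (m∣m*n y)) (m∣m*n x)
  b∣d : b ∣ d
  b∣d = coprime-divisor (Coprime.sym cop) b∣a*d

least-below? : ∀ {Q : ℕ → Set} → Decidable Q → ∀ n →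
  (∃[ m ] (m < n × Q m × ∀ {k} → k < m → ¬ Q k)) ⊎ (∀ {k} → k < n → ¬ Q k)
least-below? Q? zero = inj₂ λ ()
least-below? Q? (suc n) with least-below? Q? n
... | inj₁ (m , m<n , qm , earlier) = inj₁ (m , m<n⇒m<1+n m<n , qm , earlier)
... | inj₂ none with Q? n
...   | yes qn = inj₁ (n , ≤-refl , qn , none)
...   | no ¬qn = inj₂ λ k<1+n → [ none , (λ { refl → ¬qn }) ]′ (m≤n⇒m<n∨m≡n (s≤s⁻¹ k<1+n))

pri<unp : ∀ {x y} → x < y → pos (pri x) < pos (unp y)
pri<unp {x} {y} x<y = subst (_≤ 2 * y) (*-suc 2 x) (*-monoʳ-≤ 2 x<y)

unp<pri : ∀ {x y} → x ≤ y → pos (unp x) < pos (pri y)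
unp<pri x≤y = s≤s (*-monoʳ-≤ 2 x≤y)

unp<unp⁻¹ : ∀ {x y} → pos (unp x) < pos (unp y) → x < y
unp<unp⁻¹ = *-cancelˡ-< 2 _ _

pri<pri⁻¹ : ∀ {x y} → pos (pri x) < pos (pri y) → x < y
pri<pri⁻¹ = *-cancelˡ-< 2 _ _ ∘ s<s⁻¹

pri<unp⁻¹ : ∀ {x y} → pos (pri x) < pos (unp y) → x < y
pri<unp⁻¹ = *-cancelˡ-< 2 _ _ ∘ <-trans (n<1+n _)

unp<pri⁻¹ : ∀ {x y} → pos (unp x) < pos (pri y) → x ≤ y
unp<pri⁻¹ = *-cancelˡ-≤ 2 ∘ s≤s⁻¹

module Lasers (a b : ℕ) (vs : List ℕ) where

  Laser : ℕ → ℕ → Set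
  Laser = LaserEnds a b vs

  -- Heights are scaled by b: ℓ(i) passes through the points (x, laserAt i x / b).
  H : ℕ → ℕ
  H k = b * S vs k

  laserAt : ℕ → ℕ → ℕ
  laserAt i x = H i + a * (x ∸ i)

  -- Label p lies strictly above ℓ(k), so ℓ(p) runs strictly above ℓ(k).
  laser-above-inside : ∀ {k m p} → Laser k m → Inside k m p → H (suc m) < laserAt p (suc m)
  laser-above-inside {k} {m} {suc p} (_ , _ , _ , _ , crosses , below) (k<p , p<m) = begin-strict
    H (suc m)                                        <⟨ crosses ⟩
    H k + a * (suc m ∸ k)                            ≡⟨ cong (λ d → H k + a * d) split ⟩
    H k + a * ((suc p ∸ k) + (suc m ∸ suc p))        ≡⟨ cong (H k +_) (*-distribˡ-+ a (suc p ∸ k) _) ⟩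
    H k + (a * (suc p ∸ k) + a * (suc m ∸ suc p))    ≡⟨ sym (+-assoc (H k) _ _) ⟩
    laserAt k (suc p) + a * (suc m ∸ suc p)          <⟨ +-monoˡ-< _ (below p (s≤s⁻¹ k<p) p<m) ⟩
    laserAt (suc p) (suc m)                          ∎
    where
    open ≤-Reasoning
    split : suc m ∸ k ≡ (suc p ∸ k) + (suc m ∸ suc p)
    split = ∸-split (<⇒≤ k<p) (m≤n⇒m≤1+n p<m)

  laser-nested : ∀ {k m p e} → Laser k m → Inside k m p → Laser p e → e ≤ m
  laser-nested {m = m} {e = e} lk inside@(_ , p≤m) (_ , _ , _ , _ , _ , below) with e ≤? m
  ... | yes e≤m = e≤m
  ... | no e≰m = contradiction (below m p≤m (≰⇒> e≰m)) (<-asym (laser-above-inside lk inside))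

  laser-unique : ∀ {i m m′} → Laser i m → Laser i m′ → m ≡ m′
  laser-unique {m = m} {m′}
    (_ , i≤m , _ , _ , crosses , below) (_ , i≤m′ , _ , _ , crosses′ , below′) with <-cmp m m′
  ... | tri< m<m′ _ _ = contradiction (below′ m i≤m m<m′) (<-asym crosses)
  ... | tri≈ _ m≡m′ _ = m≡m′
  ... | tri> _ _ m′<m = contradiction (below m′ i≤m′ m′<m) (<-asym crosses′)

module Dyck (a n : ℕ) (vs : List ℕ) (cop : Coprime a (suc n)) (dyck : IsDyck a (suc n) vs) where

  open Lasers a (suc n) vs

  P : ℕ → ℕ → Set
  P = Prel a (suc n) vs

  laser-source-InRange : ∀ {i m} → Laser i m → InRange n i
  laser-source-InRange (1≤i , i≤m , m<b , _) = 1≤i , ≤-trans i≤m (s≤s⁻¹ m<b)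

  laser-end-InRange : ∀ {i m} → Laser i m → InRange n m
  laser-end-InRange (1≤i , i≤m , m<b , _) = ≤-trans 1≤i i≤m , s≤s⁻¹ m<b

  final-height : S vs (suc n) ≡ a
  final-height =
    trans (cong sum (take-all (suc n) vs (≤-reflexive (proj₁ dyck)))) (proj₁ (proj₂ dyck))

  label-above-diagonal : ∀ {i} → 1 ≤ i → i ≤ n → a * i < H i
  label-above-diagonal {i} 1≤i i≤n = ≤∧≢⇒< (proj₂ (proj₂ dyck) i 1≤i (m≤n⇒m≤1+n i≤n)) λ eq →
    b*x+a*d≢b*y cop 1≤i (s≤s i≤n) 0 (S vs i) (trans (cong (_+ a * i) (*-zeroʳ (suc n))) eq)

  laser-crosses-last-step : ∀ {i} → 1 ≤ i → i ≤ n → H (suc n) < laserAt i (suc n)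
  laser-crosses-last-step {i} 1≤i i≤n = begin-strict
    H (suc n)                ≡⟨ cong (suc n *_) final-height ⟩
    suc n * a                ≡⟨ *-comm (suc n) a ⟩
    a * suc n                ≡⟨ cong (a *_) (sym (m+[n∸m]≡n (m≤n⇒m≤1+n i≤n))) ⟩
    a * (i + (suc n ∸ i))    ≡⟨ *-distribˡ-+ a i _ ⟩
    a * i + a * (suc n ∸ i)  <⟨ +-monoˡ-< _ (label-above-diagonal 1≤i i≤n) ⟩
    laserAt i (suc n)        ∎
    where open ≤-Reasoning

  below-unless-crosses : ∀ {i k} → i ≤ k → k < n →
    ¬ (H (suc k) < laserAt i (suc k)) → laserAt i (suc k) < H (suc k)
  below-unless-crosses {i} {k} i≤k k<n ¬crosses = ≤∧≢⇒< (≮⇒≥ ¬crosses)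
    (b*x+a*d≢b*y cop (m<n⇒0<n∸m (s≤s i≤k)) (≤-<-trans (m∸n≤m (suc k) i) (s≤s k<n))
                 (S vs i) (S vs (suc k)))

  laser-exists : ∀ {i} → 1 ≤ i → i ≤ n → 0 < v vs i → ∃[ m ] Laser i m
  laser-exists {i} 1≤i i≤n 0<vᵢ
    with least-below? (λ m → i ≤? m ×-dec H (suc m) <? laserAt i (suc m)) (suc n)
  ... | inj₁ (m , m<b , (i≤m , crosses) , earlier) =
    m , 1≤i , i≤m , m<b , 0<vᵢ , crosses ,
    λ k i≤k k<m → below-unless-crosses i≤k (<-≤-trans k<m (s≤s⁻¹ m<b)) (earlier k<m ∘ (i≤k ,_))
  ... | inj₂ none = contradiction (i≤n , laser-crosses-last-step 1≤i i≤n) (none ≤-refl)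

  laser? : ∀ i → (∃[ m ] Laser i m) ⊎ (∀ {m} → ¬ Laser i m)
  laser? i with 1 ≤? i | i ≤? n | 0 <? v vs i
  ... | yes 1≤i | yes i≤n | yes 0<vᵢ = inj₁ (laser-exists 1≤i i≤n 0<vᵢ)
  ... | no 1≰i | _ | _ = inj₂ λ (1≤i , _) → 1≰i 1≤i
  ... | yes _ | no i≰n | _ = inj₂ λ (_ , i≤m , m<b , _) → i≰n (s≤s⁻¹ (≤-<-trans i≤m m<b))
  ... | yes _ | yes _ | no 0≮vᵢ = inj₂ λ (_ , _ , _ , 0<vᵢ , _) → 0≮vᵢ 0<vᵢ

  root : ℕ → ℕ
  root i with laser? i
  ... | inj₁ (m , _) = m
  ... | inj₂ _ = i

  root-laser : ∀ {i m} → Laser i m → root i ≡ m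
  root-laser {i} l with laser? i
  ... | inj₁ (_ , l′) = laser-unique l′ l
  ... | inj₂ none = contradiction l none

  laser-root : ∀ {i} → i < root i → Laser i (root i)
  laser-root {i} i<root with laser? i
  ... | inj₁ (_ , l) = l
  ... | inj₂ _ = contradiction i<root (<-irrefl refl)

  ≤-root : ∀ i → i ≤ root i
  ≤-root i with laser? i
  ... | inj₁ (_ , (_ , i≤m , _)) = i≤m
  ... | inj₂ _ = ≤-refl

  root-≤ : ∀ {i} → i ≤ n → root i ≤ n
  root-≤ {i} i≤n with laser? i
  ... | inj₁ (_ , (_ , _ , m<b , _)) = s≤s⁻¹ m<b
  ... | inj₂ _ = i≤n

  below-root : ∀ {y z r} → y ≤ z → root z ≡ r → y ≤ r
  below-root {z = z} y≤z root≡r = ≤-trans y≤z (≤-trans (≤-root z) (≤-reflexive root≡r))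

  root-nested : ∀ {k p} → Inside k (root k) p → root p ≤ root k
  root-nested {k} {p} inside@(k<p , p≤root) with laser? p
  ... | inj₁ (_ , lp) = laser-nested (laser-root (<-≤-trans k<p p≤root)) inside lp
  ... | inj₂ _ = p≤root

  root-idempotent : ∀ i → root (root i) ≡ root i
  root-idempotent i with m≤n⇒m<n∨m≡n (≤-root i)
  ... | inj₁ i<root = ≤-antisym (root-nested (i<root , ≤-refl)) (≤-root (root i))
  ... | inj₂ i≡root = sym (cong root i≡root)

  root-laser-end : ∀ {i m} → Laser i m → root m ≡ m
  root-laser-end {i} l = subst (λ r → root r ≡ r) (root-laser l) (root-idempotent i)

  laser-to-root : ∀ {i j} → i ≢ j → root i ≡ j → Laser i j
  laser-to-root {i} i≢j root≡j =
    subst (Laser i) root≡j (laser-root (≤∧≢⇒< (≤-root i) (i≢j ∘ λ i≡root → trans i≡root root≡j)))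

  root-within-laser : ∀ {k m s} → Laser k m → k ≤ s → s ≤ m → root s ≤ m
  root-within-laser {k} {m} {s} l k≤s s≤m with m≤n⇒m<n∨m≡n k≤s
  ... | inj₁ k<s =
    subst (root s ≤_) (root-laser l) (root-nested (k<s , subst (s ≤_) (sym (root-laser l)) s≤m))
  ... | inj₂ refl = ≤-reflexive (root-laser l)

  inside-suc-root⇒< : ∀ {k p} → Inside k (root k) (suc (root p)) → k < p
  inside-suc-root⇒< {k} {p} (k≤root , root<) with <-cmp k p
  ... | tri< k<p _ _ = k<p
  ... | tri≈ _ refl _ = contradiction root< (<-irrefl refl)
  ... | tri> _ _ p<k = contradiction root< (≤⇒≯ (root-nested (p<k , s≤s⁻¹ k≤root)))

  -- suc (innerCover p) is the least label of the block of p in P.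
  innerCover : ℕ → ℕ
  innerCover p = max 0 (filter (λ s → p ≤? root s) (upTo p))

  innerCover-maximal : ∀ {k p} → Inside k (root k) p → k ≤ innerCover p
  innerCover-maximal {p = p} (k<p , p≤root) =
    All.lookup (xs≤max 0 _) (∈-filter⁺ (λ s → p ≤? root s) (∈-upTo⁺ k<p) p≤root)

  innerCover-inside : ∀ p → innerCover p ≡ 0 ⊎ Inside (innerCover p) (root (innerCover p)) p
  innerCover-inside p = argmax-all id {P = λ s → s ≡ 0 ⊎ Inside s (root s) p} (inj₁ refl)
    (All.tabulate λ s∈ → let (s∈upTo , p≤root) = ∈-filter⁻ (λ s → p ≤? root s) s∈ in
                         inj₂ (∈-upTo⁻ s∈upTo , p≤root))

  innerCover-< : ∀ {p} → 0 < p → innerCover p < p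
  innerCover-< {p} 0<p with innerCover-inside p
  ... | inj₁ ≡0 = subst (_< p) (sym ≡0) 0<p
  ... | inj₂ (s<p , _) = s<p

  innerCover-suc-root : ∀ {p} → 1 ≤ p → innerCover (suc (root p)) < p
  innerCover-suc-root {p} 1≤p with innerCover-inside (suc (root p))
  ... | inj₁ ≡0 = subst (_< p) (sym ≡0) 1≤p
  ... | inj₂ inside = inside-suc-root⇒< inside

  P-sym : ∀ {x y} → P x y → P y x
  P-sym (rx , ry , ¬sep) = ry , rx , λ (k , m , l , side) →
    ¬sep (k , m , l , Sum.swap (Sum.map Product.swap Product.swap side))

  inside-resp-P : ∀ {x y k m} → P x y → Laser k m → Inside k m x → Inside k m y
  inside-resp-P {y = y} {k} {m} (_ , _ , ¬sep) l ix with k <? y ×-dec y ≤? m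
  ... | yes iy = iy
  ... | no ¬iy = contradiction (k , m , l , inj₁ (ix , ¬iy)) ¬sep

  P-innerCover : ∀ {p} → InRange n p → P (suc (innerCover p)) p
  P-innerCover {p} rp@(1≤p , p≤n) = (s≤s z≤n , ≤-trans s<p p≤n) , rp , ¬sep
    where
    s<p : innerCover p < p
    s<p = innerCover-< 1≤p
    ¬sep : ¬ Separated a (suc n) vs (suc (innerCover p)) p
    ¬sep (k , m , l , inj₁ ((k<1+s , 1+s≤m) , ¬ip)) with innerCover-inside p
    ... | inj₁ s≡0 = <⇒≱ (proj₁ l) (subst (k ≤_) s≡0 (s≤s⁻¹ k<1+s))
    ... | inj₂ (_ , p≤root) = ¬ip (≤-<-trans (s≤s⁻¹ k<1+s) s<p ,
                                   ≤-trans p≤root (root-within-laser l (s≤s⁻¹ k<1+s) (<⇒≤ 1+s≤m)))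
    ¬sep (k , m , l , inj₂ (¬i1+s , k<p , p≤m)) =
      ¬i1+s (s≤s (innerCover-maximal (k<p , subst (p ≤_) (sym (root-laser l)) p≤m)) , ≤-trans s<p p≤m)

  SameRoot : ℕ → ℕ → Set
  SameRoot i j = InRange n i × InRange n j × root i ≡ root j

  SameRoot-isPartition : IsPartition n SameRoot
  SameRoot-isPartition =
      (λ _ _ (rᵢ , rⱼ , _) → rᵢ , rⱼ)
    , (λ _ r → r , r , refl)
    , (λ _ _ (rᵢ , rⱼ , eq) → rⱼ , rᵢ , sym eq)
    , (λ _ _ _ (rᵢ , _ , eq) (_ , rₖ , eq′) → rᵢ , rₖ , trans eq eq′)

  P-noncrossing : ∀ {x y z w} → x < y → y < z → z < w → P x z → P y w → P x y
  P-noncrossing {x} {y} x<y y<z z<w pxz@(rx , _) pyw@(ry , _) = rx , ry , ¬sep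
    where
    ¬sep : ¬ Separated a (suc n) vs x y
    ¬sep (k , m , l , inj₁ (ix@(k<x , _) , ¬iy)) =
      ¬iy (<-trans k<x x<y , ≤-trans (<⇒≤ y<z) (proj₂ (inside-resp-P pxz l ix)))
    ¬sep (k , m , l , inj₂ (¬ix , iy@(k<y , _))) =
      ¬ix (inside-resp-P (P-sym pxz) l
             (<-trans k<y y<z , ≤-trans (<⇒≤ z<w) (proj₂ (inside-resp-P pyw l iy))))

  SameRoot-noncrossing : ∀ {x y z w} → x < y → y < z → z < w →
    SameRoot x z → SameRoot y w → SameRoot x y
  SameRoot-noncrossing x<y y<z z<w (rx , _ , x~z) (ry , _ , y~w) =
    rx , ry , ≤-antisym
      (subst (_≤ _) (sym x~z) (root-nested (y<z , below-root (<⇒≤ z<w) (sym y~w))))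
      (root-nested (x<y , below-root (<⇒≤ y<z) (sym x~z)))

  SameRoot-P-noncrossing : ∀ {x y z w} → x < y → y ≤ z → z < w → SameRoot x z → ¬ P y w
  SameRoot-P-noncrossing {x} {y} {z} {w} x<y y≤z z<w (_ , _ , x~z) pyw with w ≤? root x
  ... | yes w≤root =
    <⇒≱ (proj₁ (inside-resp-P (P-sym pyw) (laser-root (<-≤-trans z<w w≤root′)) (z<w , w≤root′))) y≤z
    where w≤root′ = ≤-trans w≤root (≤-reflexive x~z)
  ... | no w≰root =
    w≰root (proj₂ (inside-resp-P pyw (laser-root (<-≤-trans x<y y≤root)) (x<y , y≤root)))
    where y≤root = below-root y≤z (sym x~z)

  P-SameRoot-noncrossing : ∀ {x y z w} → x ≤ y → y < z → z ≤ w → P x z → ¬ SameRoot y w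
  P-SameRoot-noncrossing x≤y y<z z≤w pxz (_ , _ , y~w) =
    <⇒≱ (proj₁ (inside-resp-P (P-sym pxz) (laser-root (<-≤-trans y<z z≤root)) (y<z , z≤root))) x≤y
    where z≤root = below-root z≤w (sym y~w)

  SameRoot-noncrossing-P : NonCrossing (Comb P SameRoot)
  SameRoot-noncrossing-P (unp _ , unp _ , unp _ , unp _ , o₁ , o₂ , o₃ , c₁ , c₂ , ¬c₃) =
    ¬c₃ (P-noncrossing (unp<unp⁻¹ o₁) (unp<unp⁻¹ o₂) (unp<unp⁻¹ o₃) c₁ c₂)
  SameRoot-noncrossing-P (pri _ , pri _ , pri _ , pri _ , o₁ , o₂ , o₃ , c₁ , c₂ , ¬c₃) =
    ¬c₃ (SameRoot-noncrossing (pri<pri⁻¹ o₁) (pri<pri⁻¹ o₂) (pri<pri⁻¹ o₃) c₁ c₂)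
  SameRoot-noncrossing-P (pri _ , unp _ , pri _ , unp _ , o₁ , o₂ , o₃ , c₁ , c₂ , _) =
    SameRoot-P-noncrossing (pri<unp⁻¹ o₁) (unp<pri⁻¹ o₂) (pri<unp⁻¹ o₃) c₁ c₂
  SameRoot-noncrossing-P (unp _ , pri _ , unp _ , pri _ , o₁ , o₂ , o₃ , c₁ , c₂ , _) =
    P-SameRoot-noncrossing (unp<pri⁻¹ o₁) (pri<unp⁻¹ o₂) (unp<pri⁻¹ o₃) c₁ c₂
  SameRoot-noncrossing-P (unp _ , _ , pri _ , _ , _ , _ , _ , () , _)
  SameRoot-noncrossing-P (pri _ , _ , unp _ , _ , _ , _ , _ , () , _)
  SameRoot-noncrossing-P (unp _ , unp _ , unp _ , pri _ , _ , _ , _ , _ , () , _)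
  SameRoot-noncrossing-P (unp _ , pri _ , unp _ , unp _ , _ , _ , _ , _ , () , _)
  SameRoot-noncrossing-P (pri _ , unp _ , pri _ , pri _ , _ , _ , _ , _ , () , _)
  SameRoot-noncrossing-P (pri _ , pri _ , pri _ , unp _ , _ , _ , _ , _ , () , _)

  -- If root i ≠ root j, the label w just past the root of i (or, when j ≤ root i, of j)
  -- and the least label of its block of P give an arc of P crossing the arc {i′, j′}.
  noncrossing⇒same-root : ∀ {K : ℕ → ℕ → Set} {i j} → i < j → InRange n i → InRange n j →
    K i j → NonCrossing (Comb P K) → root i ≡ root j
  noncrossing⇒same-root {K} {i} {j} i<j (1≤i , i≤n) (1≤j , j≤n) kij noncrossing
    with root i ≟ root j | root i <? j
  ... | yes same | _ = same
  ... | no _ | yes root<j = ⊥-elim (noncrossing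
    ( unp (suc (innerCover w)) , pri i , unp w , pri j
    , unp<pri (innerCover-suc-root 1≤i) , pri<unp (s≤s (≤-root i)) , unp<pri root<j
    , P-innerCover (s≤s z≤n , ≤-trans root<j j≤n) , kij , λ () ))
    where w = suc (root i)
  ... | no distinct | no root≮j = ⊥-elim (noncrossing
    ( pri i , unp (suc (innerCover w)) , pri j , unp w
    , pri<unp (s≤s (innerCover-maximal (s≤s (≤-trans (<⇒≤ i<j) (≤-root j)) , rootj<rooti)))
    , unp<pri (innerCover-suc-root 1≤j) , pri<unp (s≤s (≤-root j))
    , kij , P-innerCover (s≤s z≤n , ≤-trans rootj<rooti (root-≤ i≤n)) , λ () ))
    where
    w = suc (root j)
    rootj<rooti : root j < root i
    rootj<rooti = ≤∧≢⇒< (root-nested (i<j , ≮⇒≥ root≮j)) (distinct ∘ sym)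

  noncrossing⊆SameRoot : ∀ {K : ℕ → ℕ → Set} → IsPartition n K → NonCrossing (Comb P K) →
    ∀ {i j} → K i j → SameRoot i j
  noncrossing⊆SameRoot {K} (range , _ , K-sym , _) noncrossing {i} {j} kij with range i j kij
  ... | rᵢ , rⱼ with <-cmp i j
  ...   | tri< i<j _ _ = rᵢ , rⱼ , noncrossing⇒same-root i<j rᵢ rⱼ kij noncrossing
  ...   | tri≈ _ refl _ = rᵢ , rⱼ , refl
  ...   | tri> _ _ j<i = rᵢ , rⱼ , sym (noncrossing⇒same-root j<i rⱼ rᵢ (K-sym i j kij) noncrossing)

  Kreweras⇔SameRoot : ∀ {K} → IsKrew n P K → ∀ {i j} → K i j ⇔ SameRoot i j
  Kreweras⇔SameRoot (K-partition , K-noncrossing , K-coarsest) = mk⇔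
    (noncrossing⊆SameRoot K-partition K-noncrossing)
    (K-coarsest SameRoot SameRoot-isPartition SameRoot-noncrossing-P _ _)

  QGen-preserves-root : ∀ {x y} → QGen a (suc n) vs x y → root x ≡ root y
  QGen-preserves-root (inj₁ (_ , lx , ly , _)) = trans (root-laser lx) (sym (root-laser ly))
  QGen-preserves-root (inj₂ (inj₁ lxy)) = trans (root-laser lxy) (sym (root-laser-end lxy))
  QGen-preserves-root (inj₂ (inj₂ lyx)) = trans (root-laser-end lyx) (sym (root-laser lyx))

  Qrel⇒SameRoot : ∀ {i j} → Qrel a (suc n) vs i j → SameRoot i j
  Qrel⇒SameRoot (rᵢ , rⱼ , chain) = rᵢ , rⱼ , gfold isEquivalence root QGen-preserves-root chain

  root-fixed⇒IsMaxOf : ∀ {R : ℕ → ℕ → Set} {j} → (∀ {k} → R j k → SameRoot j k) →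
    root j ≡ j → IsMaxOf R j
  root-fixed⇒IsMaxOf R⊆ root≡j k rjk with R⊆ rjk
  ... | _ , _ , same = below-root ≤-refl (trans (sym same) root≡j)

  IsMaxOf⇒root-fixed : ∀ {R : ℕ → ℕ → Set} {j} → (∀ {k} → SameRoot j k → R j k) →
    InRange n j → IsMaxOf R j → root j ≡ j
  IsMaxOf⇒root-fixed {j = j} SameRoot⊆ rⱼ@(1≤j , j≤n) maximal = ≤-antisym
    (maximal (root j) (SameRoot⊆ (rⱼ , (≤-trans 1≤j (≤-root j) , root-≤ j≤n) , sym (root-idempotent j))))
    (≤-root j)

lemma3p2 : (a b : ℕ) → 0 < a → 0 < b → Coprime a b →
    (vs : List ℕ) → IsDyck a b vs →
    (K : ℕ → ℕ → Set) → IsKrew (b ∸ 1) (Prel a b vs) K →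
    (i j : ℕ) →
    LaserEnds a b vs i j ⇔
      ((K i j × i ≢ j × IsMaxOf K j)
       ⊎ (i ≡ j × Qrel a b vs j j × IsMaxOf (Qrel a b vs) j × v vs j ≢ 0))
lemma3p2 a zero _ () _ _ _ _ _ _ _
lemma3p2 a (suc n) _ _ cop vs dyck K krew i j = mk⇔ to from
  where
  open Lasers a (suc n) vs
  open Dyck a n vs cop dyck
  module K⇔SameRoot {i j} = Equivalence (Kreweras⇔SameRoot krew {i} {j})

  Q : ℕ → ℕ → Set
  Q = Qrel a (suc n) vs

  Characterisation : Set
  Characterisation = (K i j × i ≢ j × IsMaxOf K j) ⊎ (i ≡ j × Q j j × IsMaxOf Q j × v vs j ≢ 0)

  to : Laser i j → Characterisation
  to l@(_ , _ , _ , 0<vᵢ , _) with i ≟ j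
  ... | yes refl =
    inj₂ (refl , (rⱼ , rⱼ , ε) , root-fixed⇒IsMaxOf {R = Q} Qrel⇒SameRoot (root-laser-end l) , >⇒≢ 0<vᵢ)
    where rⱼ = laser-end-InRange l
  ... | no i≢j =
    inj₁ (K⇔SameRoot.from same-root , i≢j , root-fixed⇒IsMaxOf {R = K} K⇔SameRoot.to (root-laser-end l))
    where
    same-root : SameRoot i j
    same-root = laser-source-InRange l , laser-end-InRange l , trans (root-laser l) (sym (root-laser-end l))

  from : Characterisation → Laser i j
  from (inj₁ (kij , i≢j , K-max)) with K⇔SameRoot.to kij
  ... | _ , rⱼ , same =
    laser-to-root i≢j (trans same (IsMaxOf⇒root-fixed {R = K} K⇔SameRoot.from rⱼ K-max))
  from (inj₂ (refl , (rⱼ@(1≤j , j≤n) , _) , Q-max , vⱼ≢0))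
    with laser-exists 1≤j j≤n (n≢0⇒n>0 vⱼ≢0)
  ... | m , l@(_ , j≤m , _) =
    subst (Laser j) (≤-antisym (Q-max m (rⱼ , laser-end-InRange l , return (inj₂ (inj₁ l)))) j≤m) l
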